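{- Let $\mathcal S=(n,I,J,K,\psi,\pi)$ be a system, let $i_1<i_2$ be elements of $I$ and let $j_1=\psi(i_1)$, $j_2=\psi(i_2)$ with $j_1<j_2$ and $j_1>\pi(i_2)$. Define $\psi':I\to J$ by $\psi'(i_1)=j_2$, $\psi'(i_2)=j_1$ and $\psi'=\psi$ elsewhere. Then $\mathcal S'=(n,I,J,K,\psi',\pi)$ is a system which improves $\mathcal S$.
   Context: A system is a tuple $\mathcal S=(n,I,J,K,\psi,\pi)$ where $n\ge2$ is an integer, $I,J,K$ are pairwise disjoint subsets of $\{2,\dots,n\}$ with $|I|=|J|\ge|K|$, $\psi:I\to J$ is a bijection, $\pi:I\to K$ is a surjection, and $i<\pi(i)<\psi(i)$ for all $i\in I$. Indices in $I$, $J$, $K$ are called exceptional, penalty and fine; other indices of $\{2,\dots,n\}$ are ordinary. For $k\in K$ put $d(k)=\min\pi^{ -1}(k)$. For $2\le r\le n$, $\theta(r)=r-2$ if $r$ is ordinary, $r-1$ if exceptional, $\psi^{ -1}(r)-1$ if penalty, $d(r)-2$ if fine. The sequence generated by $\mathcal S$ is $(y_i)_{i=0}^n$ with $y_0=1$, $y_1=2$, $y_r=y_{r-1}+y_{\theta(r)}$ ($2\le r\le n$). A system $\mathcal S'$ with the same $n$ improves $\mathcal S$ if the generated sequences satisfy $y'_n\ge y_n$. -}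

module Defs where

open import Data.Nat using (ℕ; zero; suc; _+_; _∸_; _≤_; _<_; _≡ᵇ_)
open import Data.Bool using (Bool; true; false; if_then_else_; _∧_; T)
open import Data.Maybe using (Maybe; just; nothing)
open import Data.List using (List; []; _∷_; _++_; [_])
open import Data.Product using (_×_; Σ; ∃; ∃-syntax; _,_)
open import Relation.Binary.PropositionalEquality using (_≡_)
open import Relation.Nullary using (¬_)

-- I, J, K are subsets of ℕ given by Boolean characteristic functions
-- (membership of r is  T (I r)).  ψ and π are total functions ℕ → ℕ of
-- which only the restriction to I matters.
record SysData : Set where
  constructor mkSys
  field
    n : ℕ
    I J K : ℕ → Bool
    ψ π : ℕ → ℕ

open SysData public

record IsSystem (S : SysData) : Set where
  field
    two≤n   : 2 ≤ n S
    I-range : ∀ r → T (I S r) → 2 ≤ r × r ≤ n S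
    J-range : ∀ r → T (J S r) → 2 ≤ r × r ≤ n S
    K-range : ∀ r → T (K S r) → 2 ≤ r × r ≤ n S
    IJ-disj : ∀ r → T (I S r) → ¬ T (J S r)
    IK-disj : ∀ r → T (I S r) → ¬ T (K S r)
    JK-disj : ∀ r → T (J S r) → ¬ T (K S r)
    ψ-into  : ∀ i → T (I S i) → T (J S (ψ S i))
    ψ-inj   : ∀ i i' → T (I S i) → T (I S i') → ψ S i ≡ ψ S i' → i ≡ i'
    ψ-onto  : ∀ j → T (J S j) → ∃[ i ] (T (I S i) × ψ S i ≡ j)
    π-into  : ∀ i → T (I S i) → T (K S (π S i))
    π-onto  : ∀ k → T (K S k) → ∃[ i ] (T (I S i) × π S i ≡ k)
    order   : ∀ i → T (I S i) → i < π S i × π S i < ψ S i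
  -- |I| = |J| follows from ψ being a bijection, and |J| ≥ |K| from
  -- π being a surjection I → K; hence they are not listed separately.

findFrom : (ℕ → Bool) → ℕ → ℕ → Maybe ℕ
findFrom p i zero = if p i then just i else nothing
findFrom p i (suc k) = if p i then just i else findFrom p (suc i) k

least≤ : (ℕ → Bool) → ℕ → Maybe ℕ
least≤ p m = findFrom p 0 m

fromMaybe0 : Maybe ℕ → ℕ
fromMaybe0 (just x) = x
fromMaybe0 nothing = 0

ψinv : SysData → ℕ → ℕ
ψinv S r = fromMaybe0 (least≤ (λ i → I S i ∧ (ψ S i ≡ᵇ r)) (n S))

dmin : SysData → ℕ → ℕ
dmin S k = fromMaybe0 (least≤ (λ i → I S i ∧ (π S i ≡ᵇ k)) (n S))

θ : SysData → ℕ → ℕ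
θ S r =
  if I S r then r ∸ 1
  else if J S r then ψinv S r ∸ 1
  else if K S r then dmin S r ∸ 2
  else r ∸ 2

nth : List ℕ → ℕ → ℕ
nth [] _ = 0
nth (x ∷ xs) zero = x
nth (x ∷ xs) (suc k) = nth xs k

lastOr0 : List ℕ → ℕ
lastOr0 [] = 0
lastOr0 (x ∷ []) = x
lastOr0 (x ∷ y ∷ ys) = lastOr0 (y ∷ ys)

prefix : SysData → ℕ → List ℕ
prefix S zero = 1 ∷ []
prefix S (suc zero) = 1 ∷ 2 ∷ []
prefix S (suc (suc m)) =
  let l = prefix S (suc m) in
  l ++ [ lastOr0 l + nth l (θ S (suc (suc m))) ]

-- y_r of the sequence generated by S (meaningful for r ≤ n)
y : SysData → ℕ → ℕ
y S r = nth (prefix S r) r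

Improves : SysData → SysData → Set
Improves S' S = n S' ≡ n S × y S (n S) ≤ y S' (n S')

swapψ : SysData → ℕ → ℕ → SysData
swapψ S i₁ i₂ = mkSys (n S) (I S) (J S) (K S)
  (λ r → if r ≡ᵇ i₁ then ψ S i₂ else if r ≡ᵇ i₂ then ψ S i₁ else ψ S r)
  (π S)

-- Swapping the penalties of i₁ and i₂ only changes θ at j₁ and j₂: it
-- replaces the summand y(i₁ - 1) by the larger y(i₂ - 1) at j₁, and back at
-- j₂.  The two sequences agree below j₁; on [j₁, j₂) the new one leads by at
-- least y(i₂ - 1) - y(i₁ - 1), which is exactly what is lost again at j₂;
-- from then on both obey the same recurrence, so the new one stays ahead.
module Submission where

open import Defs
open import Algebra.Properties.CommutativeSemigroup using (xy∙z≈xz∙y)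
open import Data.Bool using (true; false; if_then_else_; _∧_; T)
open import Data.Bool.Properties using (T-∧; T-≡)
open import Data.Empty using (⊥-elim)
open import Data.List using (List; []; _∷_; _++_; [_]; length)
open import Data.List.Properties using (length-++)
open import Data.Maybe using (just; nothing)
open import Data.Nat using (ℕ; zero; suc; pred; _+_; _∸_; _≤_; _<_; _≤′_; ≤′-refl; ≤′-step; _≡ᵇ_; _≟_; z≤n; s≤s)
open import Data.Nat.Induction using (<-rec)
open import Data.Nat.Properties
open import Data.Product using (_×_; _,_; proj₁; proj₂; ∃-syntax)
open import Data.Sum using (inj₁; inj₂)
open import Function.Bundles using (Equivalence)
open import Relation.Binary.Definitions using (tri<; tri≈; tri>)
open import Relation.Binary.PropositionalEquality hiding ([_]; J)
open import Relation.Nullary using (yes; no)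

open Equivalence using (to; from)

≡ᵇ-refl : ∀ n → (n ≡ᵇ n) ≡ true
≡ᵇ-refl n = T-≡ .to (≡⇒≡ᵇ n n refl)

≢⇒≡ᵇ≡false : ∀ {m n} → m ≢ n → (m ≡ᵇ n) ≡ false
≢⇒≡ᵇ≡false {m} {n} m≢n with m ≡ᵇ n in e
... | true = ⊥-elim (m≢n (≡ᵇ⇒≡ m n (T-≡ .from e)))
... | false = refl

findFrom-sound : ∀ p m i {z} → findFrom p i m ≡ just z → T (p z)
findFrom-sound p zero i eq with p i in e
findFrom-sound p zero i refl | true = T-≡ .from e
findFrom-sound p zero i () | false
findFrom-sound p (suc m) i eq with p i in e
findFrom-sound p (suc m) i refl | true = T-≡ .from e
... | false = findFrom-sound p m (suc i) eq

findFrom-complete : ∀ p m i {x} → T (p x) → i ≤ x → x ≤ i + m →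
                    ∃[ z ] findFrom p i m ≡ just z
findFrom-complete p zero i {x} px i≤x x≤i+m with p i in e
... | true = i , refl
... | false with refl ← ≤-antisym (subst (x ≤_) (+-identityʳ i) x≤i+m) i≤x =
  ⊥-elim (subst T e px)
findFrom-complete p (suc m) i {x} px i≤x x≤i+m with p i in e
... | true = i , refl
... | false with m≤n⇒m<n∨m≡n i≤x
... | inj₁ i<x = findFrom-complete p m (suc i) px i<x (subst (x ≤_) (+-suc i m) x≤i+m)
... | inj₂ refl = ⊥-elim (subst T e px)

findFrom-cong : ∀ {p q} → (∀ k → p k ≡ q k) → ∀ i m → findFrom p i m ≡ findFrom q i m
findFrom-cong p≗q i zero rewrite p≗q i = refl
findFrom-cong p≗q i (suc m) rewrite p≗q i | findFrom-cong p≗q (suc i) m = refl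

-- This also covers the junk value 0 returned by a failed search.
least≤-bounded : ∀ p m {r} → (∀ i → T (p i) → i ≤ r) → fromMaybe0 (least≤ p m) ≤ r
least≤-bounded p m bound with least≤ p m in e
... | nothing = z≤n
... | just i = bound i (findFrom-sound p m 0 e)

nth-++ˡ : ∀ (l : List ℕ) x {k} → k < length l → nth (l ++ [ x ]) k ≡ nth l k
nth-++ˡ (_ ∷ l) x {zero} _ = refl
nth-++ˡ (_ ∷ l) x {suc k} (s≤s k<len) = nth-++ˡ l x k<len

nth-++ʳ : ∀ (l : List ℕ) x {k} → length l ≡ k → nth (l ++ [ x ]) k ≡ x
nth-++ʳ [] x refl = refl
nth-++ʳ (_ ∷ l) x refl = nth-++ʳ l x refl

lastOr0-++ : ∀ (l : List ℕ) x → lastOr0 (l ++ [ x ]) ≡ x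
lastOr0-++ [] x = refl
lastOr0-++ (_ ∷ []) x = refl
lastOr0-++ (_ ∷ a ∷ l) x = lastOr0-++ (a ∷ l) x

length-prefix : ∀ S m → length (prefix S m) ≡ suc m
length-prefix S zero = refl
length-prefix S (suc zero) = refl
length-prefix S (suc (suc m)) = begin
  length (prefix S (suc m) ++ [ _ ])  ≡⟨ length-++ (prefix S (suc m)) ⟩
  length (prefix S (suc m)) + 1       ≡⟨ +-comm _ 1 ⟩
  suc (length (prefix S (suc m)))     ≡⟨ cong suc (length-prefix S (suc m)) ⟩
  suc (suc (suc m))                   ∎
  where open ≡-Reasoning

prefix-suc : ∀ S m → prefix S (suc m) ≡ prefix S m ++ [ y S (suc m) ]
prefix-suc S zero = refl
prefix-suc S (suc m) =
  cong (λ x → prefix S (suc m) ++ [ x ]) (sym (nth-++ʳ (prefix S (suc m)) _ (length-prefix S (suc m))))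

nth-prefix : ∀ S {k m} → k ≤′ m → nth (prefix S m) k ≡ y S k
nth-prefix S ≤′-refl = refl
nth-prefix S {k} {suc m} (≤′-step k≤′m) = begin
  nth (prefix S (suc m)) k                 ≡⟨ cong (λ l → nth l k) (prefix-suc S m) ⟩
  nth (prefix S m ++ [ y S (suc m) ]) k    ≡⟨ nth-++ˡ (prefix S m) _ k<len ⟩
  nth (prefix S m) k                       ≡⟨ nth-prefix S k≤′m ⟩
  y S k                                    ∎
  where
  open ≡-Reasoning
  k<len : k < length (prefix S m)
  k<len = subst (k <_) (sym (length-prefix S m)) (s≤s (≤′⇒≤ k≤′m))

-- The recurrence holds as soon as θ points backwards; otherwise nth reads junk.
y-suc-suc : ∀ S m → θ S (2 + m) ≤ 1 + m → y S (2 + m) ≡ y S (1 + m) + y S (θ S (2 + m))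
y-suc-suc S m θ≤ = begin
  y S (2 + m)                              ≡⟨ nth-++ʳ l _ (length-prefix S (suc m)) ⟩
  lastOr0 l + nth l (θ S (2 + m))          ≡⟨ cong₂ _+_ last-l (nth-prefix S (≤⇒≤′ θ≤)) ⟩
  y S (1 + m) + y S (θ S (2 + m))          ∎
  where
  open ≡-Reasoning
  l : List ℕ
  l = prefix S (suc m)
  last-l : lastOr0 l ≡ y S (suc m)
  last-l = trans (cong lastOr0 (prefix-suc S m)) (lastOr0-++ (prefix S m) _)

module _ {S : SysData} (sys : IsSystem S) where
  open IsSystem sys

  ψinv-ψ : ∀ i → T (I S i) → ψinv S (ψ S i) ≡ i
  ψinv-ψ i Ii with findFrom-complete (λ k → I S k ∧ (ψ S k ≡ᵇ ψ S i)) (n S) 0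
                     (T-∧ .from (Ii , ≡⇒≡ᵇ (ψ S i) (ψ S i) refl)) z≤n (proj₂ (I-range i Ii))
  ... | z , found with T-∧ .to (findFrom-sound _ (n S) 0 found)
  ... | Iz , ψz≡ψi = trans (cong fromMaybe0 found) (ψ-inj z i Iz Ii (≡ᵇ⇒≡ _ _ ψz≡ψi))

  θ-ψ : ∀ i → T (I S i) → θ S (ψ S i) ≡ i ∸ 1
  θ-ψ i Ii with I S (ψ S i) in isI | J S (ψ S i) in isJ
  ... | true  | _     = ⊥-elim (IJ-disj _ (T-≡ .from isI) (ψ-into i Ii))
  ... | false | true  = cong (_∸ 1) (ψinv-ψ i Ii)
  ... | false | false = ⊥-elim (subst T isJ (ψ-into i Ii))

  θ< : ∀ {r} → 1 ≤ r → θ S r < r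
  θ< {suc r} _ with I S (suc r) | J S (suc r) | K S (suc r)
  ... | true  | _     | _     = n<1+n r
  ... | false | true  | _     = s≤s (∸-monoˡ-≤ 1 (least≤-bounded _ (n S) ψ-preimage≤))
    where
    ψ-preimage≤ : ∀ i → T (I S i ∧ (ψ S i ≡ᵇ suc r)) → i ≤ suc r
    ψ-preimage≤ i t = let (Ii , ψi≡r) = T-∧ .to t in
      subst (i ≤_) (≡ᵇ⇒≡ _ _ ψi≡r) (<⇒≤ (<-trans (proj₁ (order i Ii)) (proj₂ (order i Ii))))
  ... | false | false | true  =
    s≤s (≤-trans (∸-monoˡ-≤ 2 (least≤-bounded _ (n S) π-preimage≤)) (m∸n≤m r 1))
    where
    π-preimage≤ : ∀ i → T (I S i ∧ (π S i ≡ᵇ suc r)) → i ≤ suc r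
    π-preimage≤ i t = let (Ii , πi≡r) = T-∧ .to t in
      subst (i ≤_) (≡ᵇ⇒≡ _ _ πi≡r) (<⇒≤ (proj₁ (order i Ii)))
  ... | false | false | false = s≤s (m∸n≤m r 1)

  y-rec : ∀ {r t} → 2 ≤ r → θ S r ≡ t → y S r ≡ y S (pred r) + y S t
  y-rec {suc (suc m)} (s≤s (s≤s _)) refl = y-suc-suc S m (≤-pred (θ< (s≤s z≤n)))

  y-≤-suc : ∀ r → y S r ≤ y S (suc r)
  y-≤-suc zero = s≤s z≤n
  y-≤-suc (suc r) = subst (y S (suc r) ≤_) (sym (y-rec {suc (suc r)} (s≤s (s≤s z≤n)) refl)) (m≤m+n _ _)

  y-mono : ∀ {r s} → r ≤′ s → y S r ≤ y S s
  y-mono ≤′-refl = ≤-refl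
  y-mono (≤′-step {s} r≤′s) = ≤-trans (y-mono r≤′s) (y-≤-suc s)

pred< : ∀ {r} → 1 ≤ r → pred r < r
pred< (s≤s _) = ≤-refl

transpose : ℕ → ℕ → ℕ → ℕ
transpose i j r = if r ≡ᵇ i then j else if r ≡ᵇ j then i else r

ψ-swapψ : ∀ S i j r → ψ (swapψ S i j) r ≡ ψ S (transpose i j r)
ψ-swapψ S i j r with r ≡ᵇ i | r ≡ᵇ j
... | true  | _     = refl
... | false | true  = refl
... | false | false = refl

transpose-closed : ∀ (P : ℕ → Set) {i j r} → P i → P j → P r → P (transpose i j r)
transpose-closed P {i} {j} {r} Pi Pj Pr with r ≡ᵇ i | r ≡ᵇ j
... | true  | _     = Pj
... | false | true  = Pi
... | false | false = Pr

transposeˡ : ∀ i j → transpose i j i ≡ j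
transposeˡ i j rewrite ≡ᵇ-refl i = refl

transposeʳ : ∀ i j → transpose i j j ≡ i
transposeʳ i j with j ≡ᵇ i in e
... | true = ≡ᵇ⇒≡ j i (T-≡ .from e)
... | false rewrite ≡ᵇ-refl j = refl

transpose-other : ∀ {i j r} → r ≢ i → r ≢ j → transpose i j r ≡ r
transpose-other r≢i r≢j rewrite ≢⇒≡ᵇ≡false r≢i | ≢⇒≡ᵇ≡false r≢j = refl

transpose-involutive : ∀ i j r → transpose i j (transpose i j r) ≡ r
transpose-involutive i j r with r ≟ i | r ≟ j
... | yes refl | _ = trans (cong (transpose r j) (transposeˡ r j)) (transposeʳ r j)
... | no _ | yes refl = trans (cong (transpose i r) (transposeʳ i r)) (transposeˡ i r)
... | no r≢i | no r≢j = trans (cong (transpose i j) (transpose-other r≢i r≢j)) (transpose-other r≢i r≢j)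

module Swap (S : SysData) (sys : IsSystem S) (i₁ i₂ : ℕ)
  (I-i₁ : T (I S i₁)) (I-i₂ : T (I S i₂)) (i₁<i₂ : i₁ < i₂)
  (j₁<j₂ : ψ S i₁ < ψ S i₂) (πi₂<j₁ : π S i₂ < ψ S i₁) where
  open IsSystem sys

  S′ : SysData
  S′ = swapψ S i₁ i₂

  j₁ j₂ ι₁ ι₂ : ℕ
  j₁ = ψ S i₁
  j₂ = ψ S i₂
  ι₁ = i₁ ∸ 1
  ι₂ = i₂ ∸ 1

  ψ′-i₁ : ψ S′ i₁ ≡ j₂
  ψ′-i₁ = trans (ψ-swapψ S i₁ i₂ i₁) (cong (ψ S) (transposeˡ i₁ i₂))

  ψ′-i₂ : ψ S′ i₂ ≡ j₁
  ψ′-i₂ = trans (ψ-swapψ S i₁ i₂ i₂) (cong (ψ S) (transposeʳ i₁ i₂))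

  ψ′-other : ∀ {i} → i ≢ i₁ → i ≢ i₂ → ψ S′ i ≡ ψ S i
  ψ′-other {i} i≢i₁ i≢i₂ = trans (ψ-swapψ S i₁ i₂ i) (cong (ψ S) (transpose-other i≢i₁ i≢i₂))

  τ : ℕ → ℕ
  τ = transpose i₁ i₂

  I-τ : ∀ {i} → T (I S i) → T (I S (τ i))
  I-τ = transpose-closed (λ k → T (I S k)) I-i₁ I-i₂

  π<ψ′ : ∀ i → T (I S i) → π S i < ψ S′ i
  π<ψ′ i Ii with i ≟ i₁ | i ≟ i₂
  ... | yes refl | _ = subst (π S i₁ <_) (sym ψ′-i₁) (<-trans (proj₂ (order i₁ I-i₁)) j₁<j₂)
  ... | no _ | yes refl = subst (π S i₂ <_) (sym ψ′-i₂) πi₂<j₁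
  ... | no i≢i₁ | no i≢i₂ = subst (π S i <_) (sym (ψ′-other i≢i₁ i≢i₂)) (proj₂ (order i Ii))

  ψ′-into : ∀ i → T (I S i) → T (J S (ψ S′ i))
  ψ′-into i Ii = subst (λ j → T (J S j)) (sym (ψ-swapψ S i₁ i₂ i)) (ψ-into (τ i) (I-τ Ii))

  ψ′-inj : ∀ i i′ → T (I S i) → T (I S i′) → ψ S′ i ≡ ψ S′ i′ → i ≡ i′
  ψ′-inj i i′ Ii Ii′ ψ′i≡ψ′i′ = begin
    i         ≡⟨ sym (transpose-involutive i₁ i₂ i) ⟩
    τ (τ i)   ≡⟨ cong τ (ψ-inj (τ i) (τ i′) (I-τ Ii) (I-τ Ii′) ψτi≡ψτi′) ⟩
    τ (τ i′)  ≡⟨ transpose-involutive i₁ i₂ i′ ⟩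
    i′        ∎
    where
    open ≡-Reasoning
    ψτi≡ψτi′ : ψ S (τ i) ≡ ψ S (τ i′)
    ψτi≡ψτi′ = trans (sym (ψ-swapψ S i₁ i₂ i)) (trans ψ′i≡ψ′i′ (ψ-swapψ S i₁ i₂ i′))

  ψ′-onto : ∀ j → T (J S j) → ∃[ i ] (T (I S i) × ψ S′ i ≡ j)
  ψ′-onto j Jj with ψ-onto j Jj
  ... | i , Ii , ψi≡j = τ i , I-τ Ii ,
    trans (ψ-swapψ S i₁ i₂ (τ i)) (trans (cong (ψ S) (transpose-involutive i₁ i₂ i)) ψi≡j)

  isSystem′ : IsSystem S′
  isSystem′ = record
    { two≤n = two≤n ; I-range = I-range ; J-range = J-range ; K-range = K-range
    ; IJ-disj = IJ-disj ; IK-disj = IK-disj ; JK-disj = JK-disj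
    ; ψ-into = ψ′-into ; ψ-inj = ψ′-inj ; ψ-onto = ψ′-onto
    ; π-into = π-into ; π-onto = π-onto
    ; order = λ i Ii → proj₁ (order i Ii) , π<ψ′ i Ii
    }

  θ′-other : ∀ {r} → r ≢ j₁ → r ≢ j₂ → θ S′ r ≡ θ S r
  θ′-other {r} r≢j₁ r≢j₂ =
    cong (λ p → if I S r then r ∸ 1 else if J S r then p ∸ 1
                else if K S r then dmin S r ∸ 2 else r ∸ 2)
         (cong fromMaybe0 (findFrom-cong (λ k → cong (I S k ∧_) (same-preimage k)) 0 (n S)))
    where
    same-preimage : ∀ k → (ψ S′ k ≡ᵇ r) ≡ (ψ S k ≡ᵇ r)
    same-preimage k with k ≟ i₁ | k ≟ i₂
    ... | yes refl | _ = trans (cong (_≡ᵇ r) ψ′-i₁)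
        (trans (≢⇒≡ᵇ≡false (≢-sym r≢j₂)) (sym (≢⇒≡ᵇ≡false (≢-sym r≢j₁))))
    ... | no _ | yes refl = trans (cong (_≡ᵇ r) ψ′-i₂)
        (trans (≢⇒≡ᵇ≡false (≢-sym r≢j₁)) (sym (≢⇒≡ᵇ≡false (≢-sym r≢j₂))))
    ... | no k≢i₁ | no k≢i₂ = cong (_≡ᵇ r) (ψ′-other k≢i₁ k≢i₂)

  θ′-j₁ : θ S′ j₁ ≡ ι₂
  θ′-j₁ = subst (λ j → θ S′ j ≡ ι₂) ψ′-i₂ (θ-ψ isSystem′ i₂ I-i₂)

  θ′-j₂ : θ S′ j₂ ≡ ι₁
  θ′-j₂ = subst (λ j → θ S′ j ≡ ι₁) ψ′-i₁ (θ-ψ isSystem′ i₁ I-i₁)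

  a b : ℕ → ℕ
  a = y S
  b = y S′

  2≤j₁ : 2 ≤ j₁
  2≤j₁ = ≤-<-trans (≤-trans (s≤s z≤n) (proj₁ (order i₂ I-i₂))) πi₂<j₁

  2≤j₂ : 2 ≤ j₂
  2≤j₂ = <-trans 2≤j₁ j₁<j₂

  ι₂<j₁ : ι₂ < j₁
  ι₂<j₁ = ≤-<-trans (m∸n≤m i₂ 1) (<-trans (proj₁ (order i₂ I-i₂)) πi₂<j₁)

  ι₁≤ι₂ : ι₁ ≤ ι₂
  ι₁≤ι₂ = ∸-monoˡ-≤ 1 (<⇒≤ i₁<i₂)

  b-rec-other : ∀ {r} → 2 ≤ r → r ≢ j₁ → r ≢ j₂ → b r ≡ b (pred r) + b (θ S r)
  b-rec-other 2≤r r≢j₁ r≢j₂ = y-rec isSystem′ 2≤r (θ′-other r≢j₁ r≢j₂)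

  agree : ∀ r → r < j₁ → b r ≡ a r
  agree = <-rec (λ r → r < j₁ → b r ≡ a r) step
    where
    step : ∀ r → (∀ {s} → s < r → s < j₁ → b s ≡ a s) → r < j₁ → b r ≡ a r
    step zero _ _ = refl
    step (suc zero) _ _ = refl
    step r@(suc (suc _)) ih r<j₁ = begin
      b r                     ≡⟨ b-rec-other 2≤r (<⇒≢ r<j₁) (<⇒≢ (<-trans r<j₁ j₁<j₂)) ⟩
      b (pred r) + b (θ S r)  ≡⟨ cong₂ _+_ (ih p<r (<-trans p<r r<j₁)) (ih θ<r (<-trans θ<r r<j₁)) ⟩
      a (pred r) + a (θ S r)  ≡⟨ sym (y-rec sys 2≤r refl) ⟩
      a r                     ∎
      where
      open ≡-Reasoning
      2≤r : 2 ≤ r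
      2≤r = s≤s (s≤s z≤n)
      p<r : pred r < r
      p<r = pred< (<⇒≤ 2≤r)
      θ<r : θ S r < r
      θ<r = θ< sys (<⇒≤ 2≤r)

  Gap : ℕ → Set
  Gap r = a r + a ι₂ ≤ b r + a ι₁

  gap⇒≤ : ∀ r → Gap r → a r ≤ b r
  gap⇒≤ r gap = +-cancelʳ-≤ (a ι₂) (a r) (b r)
    (≤-trans gap (+-monoʳ-≤ (b r) (y-mono sys (≤⇒≤′ ι₁≤ι₂))))

  gap-j₁ : Gap j₁
  gap-j₁ = begin
    a j₁ + a ι₂        ≡⟨ cong (_+ a ι₂) (y-rec sys 2≤j₁ (θ-ψ sys i₁ I-i₁)) ⟩
    a p + a ι₁ + a ι₂  ≡⟨ xy∙z≈xz∙y +-commutativeSemigroup (a p) (a ι₁) (a ι₂) ⟩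
    a p + a ι₂ + a ι₁  ≡⟨ cong₂ (λ u v → u + v + a ι₁) (sym (agree p (pred< (<⇒≤ 2≤j₁))))
                                                         (sym (agree ι₂ ι₂<j₁)) ⟩
    b p + b ι₂ + a ι₁  ≡⟨ cong (_+ a ι₁) (sym (y-rec isSystem′ 2≤j₁ θ′-j₁)) ⟩
    b j₁ + a ι₁        ∎
    where
    open ≤-Reasoning
    p : ℕ
    p = pred j₁

  Dominated : ℕ → Set
  Dominated r = a r ≤ b r × (j₁ ≤ r → r < j₂ → Gap r)

  Below : ℕ → Set
  Below r = ∀ {s} → s < r → Dominated s

  gap-between : ∀ {r} → j₁ < r → r < j₂ → Below r → Gap r
  gap-between {r} j₁<r r<j₂ below = begin
    a r + a ι₂         ≡⟨ cong (_+ a ι₂) (y-rec sys 2≤r refl) ⟩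
    a p + a t + a ι₂   ≡⟨ xy∙z≈xz∙y +-commutativeSemigroup (a p) (a t) (a ι₂) ⟩
    a p + a ι₂ + a t   ≤⟨ +-mono-≤ gap-p (proj₁ (below (θ< sys 1≤r))) ⟩
    b p + a ι₁ + b t   ≡⟨ xy∙z≈xz∙y +-commutativeSemigroup (b p) (a ι₁) (b t) ⟩
    b p + b t + a ι₁   ≡⟨ cong (_+ a ι₁) (sym (b-rec-other 2≤r (>⇒≢ j₁<r) (<⇒≢ r<j₂))) ⟩
    b r + a ι₁         ∎
    where
    open ≤-Reasoning
    p t : ℕ
    p = pred r
    t = θ S r
    2≤r : 2 ≤ r
    2≤r = <-trans 2≤j₁ j₁<r
    1≤r : 1 ≤ r
    1≤r = <⇒≤ 2≤r
    gap-p : Gap p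
    gap-p = proj₂ (below (pred< 1≤r)) (pred-mono-≤ j₁<r) (≤-<-trans pred[n]≤n r<j₂)

  ≤-j₂ : Below j₂ → a j₂ ≤ b j₂
  ≤-j₂ below = begin
    a j₂        ≡⟨ y-rec sys 2≤j₂ (θ-ψ sys i₂ I-i₂) ⟩
    a p + a ι₂  ≤⟨ proj₂ (below p<j₂) (pred-mono-≤ j₁<j₂) p<j₂ ⟩
    b p + a ι₁  ≡⟨ cong (b p +_) (sym (agree ι₁ (≤-<-trans ι₁≤ι₂ ι₂<j₁))) ⟩
    b p + b ι₁  ≡⟨ sym (y-rec isSystem′ 2≤j₂ θ′-j₂) ⟩
    b j₂        ∎
    where
    open ≤-Reasoning
    p : ℕ
    p = pred j₂
    p<j₂ : p < j₂
    p<j₂ = pred< (<⇒≤ 2≤j₂)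

  ≤-beyond : ∀ {r} → j₂ < r → Below r → a r ≤ b r
  ≤-beyond {r} j₂<r below = begin
    a r                     ≡⟨ y-rec sys 2≤r refl ⟩
    a (pred r) + a (θ S r)  ≤⟨ +-mono-≤ (proj₁ (below (pred< 1≤r))) (proj₁ (below (θ< sys 1≤r))) ⟩
    b (pred r) + b (θ S r)  ≡⟨ sym (b-rec-other 2≤r (>⇒≢ (<-trans j₁<j₂ j₂<r)) (>⇒≢ j₂<r)) ⟩
    b r                     ∎
    where
    open ≤-Reasoning
    2≤r : 2 ≤ r
    2≤r = <-trans 2≤j₂ j₂<r
    1≤r : 1 ≤ r
    1≤r = <⇒≤ 2≤r

  dominated : ∀ r → Dominated r
  dominated = <-rec Dominated step
    where
    step : ∀ r → Below r → Dominated r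
    step r below with <-cmp r j₁
    ... | tri< r<j₁ _ _ = ≤-reflexive (sym (agree r r<j₁)) , λ j₁≤r _ → ⊥-elim (<⇒≱ r<j₁ j₁≤r)
    ... | tri≈ _ refl _ = gap⇒≤ j₁ gap-j₁ , λ _ _ → gap-j₁
    ... | tri> _ _ j₁<r with <-cmp r j₂
    ...   | tri< r<j₂ _ _ = gap⇒≤ r (gap-between j₁<r r<j₂ below) , λ _ _ → gap-between j₁<r r<j₂ below
    ...   | tri≈ _ refl _ = ≤-j₂ below , λ _ j₂<j₂ → ⊥-elim (<-irrefl refl j₂<j₂)
    ...   | tri> _ _ j₂<r = ≤-beyond j₂<r below , λ _ r<j₂ → ⊥-elim (<-asym r<j₂ j₂<r)

proposition4p9 : (S : SysData) → IsSystem S → (i₁ i₂ : ℕ) →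
    T (I S i₁) → T (I S i₂) → i₁ < i₂ →
    ψ S i₁ < ψ S i₂ → π S i₂ < ψ S i₁ →
    IsSystem (swapψ S i₁ i₂) × Improves (swapψ S i₁ i₂) S
proposition4p9 S sys i₁ i₂ I-i₁ I-i₂ i₁<i₂ j₁<j₂ πi₂<j₁ =
  isSystem′ , refl , proj₁ (dominated (n S))
  where open Swap S sys i₁ i₂ I-i₁ I-i₂ i₁<i₂ j₁<j₂ πi₂<j₁
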